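{- For any positive integer $k$ and any real number $M>0$, there exist connected graphs $H$ and $G$ with $H$ a subgraph of $G$ such that $\frac{\dim_f(H)}{\dim_f(G)}>M$ and $\frac{\dim_{k,f}(H)}{\dim_{k,f}(G)}>M$.
   Context: All graphs are finite, simple, undirected and connected. $d(x,y)$ denotes the distance. For $g$ defined on $V(G)$ and $U\subseteq V(G)$, $g(U)=\sum_{s\in U}g(s)$. For distinct $x,y$, $R\{x,y\}=\{z: d(x,z)\ne d(y,z)\}$; $g:V(G)\to[0,1]$ is a resolving function if $g(R\{x,y\})\ge1$ for all distinct $x,y$; $\dim_f(G)$ is the minimum of $g(V(G))$ over resolving functions. For a positive integer $k$, $d_k(x,y)=\min\{d(x,y),k+1\}$, $R_k\{x,y\}=\{z: d_k(x,z)\neq d_k(y,z)\}$; $h:V(G)\to[0,1]$ is a $k$-truncated resolving function if $h(R_k\{x,y\})\ge1$ for all distinct $x,y$; $\dim_{k,f}(G)$ is the minimum of $h(V(G))$ over such $h$.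
   Formalization: The number M ranges over the positive rationals instead of the positive reals, and the resolving and k-truncated resolving functions take values in the rationals in [0,1]. -}

module Defs where

open import Data.Bool using (Bool; true; false; _∧_; _∨_; not; if_then_else_)
open import Data.Nat using (ℕ; zero; suc; _≡ᵇ_; _⊓_)
open import Data.Fin using (Fin; _≟_)
open import Data.List using (List; allFin; foldr; map)
open import Data.Bool.ListAction using (any)
open import Data.Rational using (ℚ; 0ℚ; 1ℚ; _+_; _≤_)
open import Data.Product using (Σ; _×_)
open import Relation.Binary.PropositionalEquality using (_≡_; _≢_)
open import Relation.Nullary.Decidable using (⌊_⌋)

record Graph (n : ℕ) : Set where
  field
    adj   : Fin n → Fin n → Bool
    sym   : ∀ x y → adj x y ≡ adj y x
    irrefl : ∀ x → adj x x ≡ false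
open Graph public

reach : ∀ {n} → Graph n → ℕ → Fin n → Fin n → Bool
reach G zero    x y = ⌊ x ≟ y ⌋
reach {n} G (suc k) x y =
  reach G k x y ∨ any (λ z → reach G k x z ∧ adj G z y) (allFin n)

Connected : ∀ {n} → Graph n → Set
Connected {n} G = ∀ x y → reach G n x y ≡ true

-- distance: least k ≤ n with a walk of length ≤ k (the usual graph distance
-- for connected graphs; the fallback value n is never used for them).
distFrom : ∀ {n} → Graph n → ℕ → ℕ → Fin n → Fin n → ℕ
distFrom G k zero    x y = k
distFrom G k (suc f) x y = if reach G k x y then k else distFrom G (suc k) f x y

dist : ∀ {n} → Graph n → Fin n → Fin n → ℕ
dist {n} G x y = distFrom G 0 (suc n) x y

distTr : ∀ {n} → ℕ → Graph n → Fin n → Fin n → ℕ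
distTr k G x y = dist G x y ⊓ suc k

Subgraph : ∀ {m n} → Graph m → Graph n → Set
Subgraph {m} {n} H G =
  Σ (Fin m → Fin n) λ f →
    (∀ x y → f x ≡ f y → x ≡ y) ×
    (∀ x y → adj H x y ≡ true → adj G (f x) (f y) ≡ true)

weight : ∀ {n} → (Fin n → ℚ) → (Fin n → Bool) → ℚ
weight {n} g P = foldr _+_ 0ℚ (map (λ z → if P z then g z else 0ℚ) (allFin n))

total : ∀ {n} → (Fin n → ℚ) → ℚ
total g = weight g (λ _ → true)

Resolving : ∀ {n} → (Fin n → Fin n → ℕ) → (Fin n → ℚ) → Set
Resolving {n} D g =
  (∀ z → 0ℚ ≤ g z) × (∀ z → g z ≤ 1ℚ) ×
  (∀ x y → x ≢ y → 1ℚ ≤ weight g (λ z → not (D x z ≡ᵇ D y z)))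

IsMinResolvingValue : ∀ {n} → (Fin n → Fin n → ℕ) → ℚ → Set
IsMinResolvingValue {n} D d =
  Σ (Fin n → ℚ) (λ g → Resolving D g × total g ≡ d) ×
  (∀ h → Resolving D h → d ≤ total h)

IsFracDim : ∀ {n} → Graph n → ℚ → Set
IsFracDim G d = IsMinResolvingValue (dist G) d

IsTruncFracDim : ∀ {n} → ℕ → Graph n → ℚ → Set
IsTruncFracDim k G d = IsMinResolvingValue (distTr k G) d

{-# OPTIONS --safe #-}

-- In a graph with a dominating vertex all distances are 0, 1 or 2, so truncating at k ≥ 1
-- changes nothing, and z resolves x ≠ y as soon as z ∈ {x, y} or z is adjacent to exactly
-- one of x and y. Twins are resolved only by themselves, so m disjoint twin pairs force
-- dim_f ≥ m, while weight ½ on a set containing two resolvers of every pair is resolving.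
-- Hence the star with 2K leaves has dim_f = K, whereas the cone over the t × t grid, whose
-- rows and columns are doubled into twin pairs and whose cells are adjacent to the copies
-- of their row and column, has dim_f = 2t. Its spanning star has 4t + t² leaves, so the
-- two dimensions have ratio 1 + t/4.
module Submission where

open import Defs hiding (sym)
open import Data.Nat using (ℕ; _≤_)
open import Data.Rational using (ℚ; 0ℚ; _<_; _*_)
open import Data.Product using (Σ; _×_)

open import Algebra.Bundles using (Ring)
open import Data.Bool using (Bool; true; false; not; _∧_; _∨_; if_then_else_; T)
open import Data.Bool.ListAction using (any)
open import Data.Bool.Properties using (∨-zeroʳ; ¬-not; not-¬; T-≡)
open import Data.Fin
  using (Fin; zero; suc; _≟_; _↑ˡ_; _↑ʳ_; splitAt; join; remQuot; combine; punchIn; punchOut)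
open import Data.Fin.Properties
  using (suc-injective; ↑ˡ-injective; splitAt-↑ˡ; splitAt-↑ʳ; splitAt-join; splitAt⁻¹-↑ˡ;
         splitAt⁻¹-↑ʳ; combine-remQuot; punchIn-punchOut; punchInᵢ≢i; punchIn-injective)
open import Data.Integer as ℤ using (+_; -[1+_])
import Data.Integer.Properties as ℤₚ
open import Data.List using (allFin; foldr; tabulate)
open import Data.List.Membership.Propositional using (lose)
open import Data.List.Membership.Propositional.Properties using (∈-allFin)
open import Data.List.Properties using (map-tabulate)
open import Data.List.Relation.Unary.Any using (satisfied)
open import Data.List.Relation.Unary.Any.Properties using (any⁺; any⁻)
open import Data.Nat as ℕ using (zero; suc; _+_; _≡ᵇ_; z≤n; s≤s; _≤′_; ≤′-reflexive; ≤′-step)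
import Data.Nat.Properties as ℕₚ
open import Data.Nat.Solver using (module +-*-Solver)
open +-*-Solver using (solve; _:+_; _:*_; _:=_; con)
open import Data.Product using (_,_; proj₁; proj₂; uncurry)
import Data.Rational as ℚ
open import Data.Rational using (1ℚ; ½; mkℚ; toℚᵘ)
import Data.Rational.Properties as ℚₚ
import Data.Rational.Unnormalised as ℚᵘ
open import Data.Rational.Unnormalised using (mkℚᵘ)
import Data.Rational.Unnormalised.Properties as ℚᵘₚ
open import Data.Sum using (_⊎_; inj₁; inj₂; [_,_]′)
import Data.Sum as Sum
open import Data.Vec.Functional using (removeAt; []; _∷_)
open import Function using (_∘_; id; Equivalence)
open import Function.Definitions using (Injective)
open import Relation.Binary.PropositionalEquality
  using (_≡_; _≢_; refl; sym; trans; cong; cong₂; subst; ≢-sym; module ≡-Reasoning)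
open import Relation.Nullary using (Dec; yes; no; ¬_; contradiction)
open import Relation.Nullary.Decidable using (⌊_⌋; isYes≗does; dec-true; dec-false; from-yes)

open import Algebra.Properties.CommutativeMonoid.Sum ℚₚ.+-0-commutativeMonoid
  using (sum; sum-remove; sum-cong-≗; sum-replicate; sum-replicate-zero; ∑-distrib-+)
open import Algebra.Properties.Semiring.Mult (Ring.semiring ℚₚ.+-*-ring)
  using (×1-homo-*) renaming (_×_ to _×ₙ_)

private
  variable
    m n : ℕ

sum-nonneg : {f : Fin n → ℚ} → (∀ i → 0ℚ ℚ.≤ f i) → 0ℚ ℚ.≤ sum f
sum-nonneg {zero}  _   = ℚₚ.≤-refl
sum-nonneg {suc n} f≥0 = ℚₚ.+-mono-≤ (f≥0 zero) (sum-nonneg (f≥0 ∘ suc))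

sum-mono-≤ : {f g : Fin n → ℚ} → (∀ i → f i ℚ.≤ g i) → sum f ℚ.≤ sum g
sum-mono-≤ {zero}  _   = ℚₚ.≤-refl
sum-mono-≤ {suc n} f≤g = ℚₚ.+-mono-≤ (f≤g zero) (sum-mono-≤ (f≤g ∘ suc))

sum-zero : {f : Fin n → ℚ} → (∀ i → f i ≡ 0ℚ) → sum f ≡ 0ℚ
sum-zero {n} f≡0 = trans (sum-cong-≗ f≡0) (sum-replicate-zero n)

sum-↑ : ∀ m (f : Fin (m + n) → ℚ) → sum f ≡ sum (f ∘ (_↑ˡ n)) ℚ.+ sum (f ∘ (m ↑ʳ_))
sum-↑ zero    f = sym (ℚₚ.+-identityˡ (sum f))
sum-↑ (suc m) f = trans (cong (f zero ℚ.+_) (sum-↑ m (f ∘ suc))) (sym (ℚₚ.+-assoc (f zero) _ _))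

sum-supported-on-point : {f : Fin n → ℚ} (i : Fin n) → (∀ j → j ≢ i → f j ≡ 0ℚ) → sum f ≡ f i
sum-supported-on-point {suc n} {f} i f≡0 = begin
  sum f                          ≡⟨ sum-remove f ⟩
  f i ℚ.+ sum (removeAt f i)     ≡⟨ cong (f i ℚ.+_) (sum-zero λ j → f≡0 (punchIn i j) (punchInᵢ≢i i j)) ⟩
  f i ℚ.+ 0ℚ                     ≡⟨ ℚₚ.+-identityʳ (f i) ⟩
  f i                            ∎
  where open ≡-Reasoning

sum-supported-on-pair : {f : Fin n → ℚ} {x y : Fin n} → x ≢ y →
  (∀ z → z ≢ x → z ≢ y → f z ≡ 0ℚ) → sum f ≡ f x ℚ.+ f y
sum-supported-on-pair {suc n} {f} {x} {y} x≢y f≡0 = begin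
  sum f                                  ≡⟨ sum-remove f ⟩
  f x ℚ.+ sum (removeAt f x)              ≡⟨ cong (f x ℚ.+_) (sum-supported-on-point j outside) ⟩
  f x ℚ.+ f (punchIn x j)                ≡⟨ cong (λ z → f x ℚ.+ f z) (punchIn-punchOut x≢y) ⟩
  f x ℚ.+ f y                            ∎
  where
  open ≡-Reasoning
  j : Fin n
  j = punchOut x≢y
  outside : ∀ k → k ≢ j → removeAt f x k ≡ 0ℚ
  outside k k≢j = f≡0 (punchIn x k) (punchInᵢ≢i x k)
    (λ eq → k≢j (punchIn-injective x k j (trans eq (sym (punchIn-punchOut x≢y)))))

sum-injective-≤ : {f : Fin n → ℚ} → (∀ i → 0ℚ ℚ.≤ f i) →
  (e : Fin m → Fin n) → Injective _≡_ _≡_ e → sum (f ∘ e) ℚ.≤ sum f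
sum-injective-≤ {m = zero}  f≥0 e _ = sum-nonneg f≥0
sum-injective-≤ {n = zero}  {m = suc m} f≥0 e _ with e zero
... | ()
sum-injective-≤ {n = suc n} {m = suc m} {f} f≥0 e e-inj = begin
  f (e zero) ℚ.+ sum (f ∘ e ∘ suc)
    ≡⟨ cong (f (e zero) ℚ.+_) (sum-cong-≗ (λ i → cong f (sym (punchIn-punchOut (e0≢ i))))) ⟩
  f (e zero) ℚ.+ sum (removeAt f (e zero) ∘ e′)
    ≤⟨ ℚₚ.+-monoʳ-≤ (f (e zero)) (sum-injective-≤ (f≥0 ∘ punchIn (e zero)) e′ e′-inj) ⟩
  f (e zero) ℚ.+ sum (removeAt f (e zero))
    ≡⟨ sum-remove f ⟨
  sum f
    ∎
  where
  open ℚₚ.≤-Reasoning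
  e0≢ : ∀ i → e zero ≢ e (suc i)
  e0≢ i eq with e-inj eq
  ... | ()
  e′ : Fin m → Fin n
  e′ i = punchOut (e0≢ i)
  e′-inj : Injective _≡_ _≡_ e′
  e′-inj {i} {j} eq = suc-injective (e-inj (trans (sym (punchIn-punchOut (e0≢ i)))
    (trans (cong (punchIn (e zero)) eq) (punchIn-punchOut (e0≢ j)))))

pair-≤-sum : {f : Fin n → ℚ} → (∀ i → 0ℚ ℚ.≤ f i) →
  {x y : Fin n} → x ≢ y → f x ℚ.+ f y ℚ.≤ sum f
pair-≤-sum {f = f} f≥0 {x} {y} x≢y = begin
  f x ℚ.+ f y                  ≡⟨ cong (f x ℚ.+_) (ℚₚ.+-identityʳ (f y)) ⟨
  sum (f ∘ (x ∷ y ∷ []))       ≤⟨ sum-injective-≤ f≥0 (x ∷ y ∷ []) pair-injective ⟩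
  sum f                        ∎
  where
  open ℚₚ.≤-Reasoning
  pair-injective : Injective _≡_ _≡_ (x ∷ y ∷ [])
  pair-injective {zero}     {zero}     _  = refl
  pair-injective {zero}     {suc zero} eq = contradiction eq x≢y
  pair-injective {suc zero} {zero}     eq = contradiction (sym eq) x≢y
  pair-injective {suc zero} {suc zero} _  = refl

sum-halves : ∀ m → sum {m + m} (λ _ → ½) ≡ m ×ₙ 1ℚ
sum-halves m = begin
  sum {m + m} (λ _ → ½)                   ≡⟨ sum-↑ m (λ _ → ½) ⟩
  sum {m} (λ _ → ½) ℚ.+ sum {m} (λ _ → ½) ≡⟨ ∑-distrib-+ {m} (λ _ → ½) (λ _ → ½) ⟨
  sum {m} (λ _ → 1ℚ)                      ≡⟨ sum-replicate m ⟩
  m ×ₙ 1ℚ                                 ∎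
  where open ≡-Reasoning

×ₙ1-nonneg : ∀ n → 0ℚ ℚ.≤ n ×ₙ 1ℚ
×ₙ1-nonneg zero    = ℚₚ.≤-refl
×ₙ1-nonneg (suc n) = ℚₚ.+-mono-≤ (from-yes (0ℚ ℚₚ.≤? 1ℚ)) (×ₙ1-nonneg n)

×ₙ1-< : ∀ {m n} → m ℕ.< n → m ×ₙ 1ℚ < n ×ₙ 1ℚ
×ₙ1-< {zero}  {suc n} _         = ℚₚ.+-mono-<-≤ (from-yes (0ℚ ℚₚ.<? 1ℚ)) (×ₙ1-nonneg n)
×ₙ1-< {suc m} {suc n} (s≤s m<n) = ℚₚ.+-monoʳ-< 1ℚ (×ₙ1-< m<n)

toℚᵘ-×ₙ1 : ∀ n → toℚᵘ (n ×ₙ 1ℚ) ℚᵘ.≃ mkℚᵘ (+ n) 0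
toℚᵘ-×ₙ1 zero    = ℚᵘₚ.≃-refl
toℚᵘ-×ₙ1 (suc n) = ℚᵘₚ.≃-trans (ℚₚ.toℚᵘ-homo-+ 1ℚ (n ×ₙ 1ℚ))
  (ℚᵘₚ.≃-trans (ℚᵘₚ.+-congʳ (toℚᵘ 1ℚ) (toℚᵘ-×ₙ1 n)) (ℚᵘ.*≡* numerators))
  where
  numerators : (+ 1 ℤ.* + 1 ℤ.+ + n ℤ.* + 1) ℤ.* + 1 ≡ + suc n ℤ.* + 1
  numerators = trans (ℤₚ.*-identityʳ _)
    (trans (cong (ℤ._+_ (+ 1)) (ℤₚ.*-identityʳ (+ n))) (sym (ℤₚ.*-identityʳ (+ suc n))))

archimedean : ∀ (M : ℚ) → Σ ℕ λ P → M ℚ.≤ P ×ₙ 1ℚ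
archimedean (mkℚ (+ n) d _)    =
  n , ℚₚ.toℚᵘ-cancel-≤ (ℚᵘₚ.≤-respʳ-≃ (ℚᵘₚ.≃-sym (toℚᵘ-×ₙ1 n)) n/d+1≤n)
  where
  n/d+1≤n : mkℚᵘ (+ n) d ℚᵘ.≤ mkℚᵘ (+ n) 0
  n/d+1≤n = ℚᵘ.*≤* (ℤₚ.*-monoˡ-≤-nonNeg (+ n) (ℤ.+≤+ (s≤s z≤n)))
archimedean (mkℚ -[1+ _ ] _ _) = 0 , ℚₚ.toℚᵘ-cancel-≤ (ℚᵘ.*≤* ℤ.-≤+)

scaled-< : ∀ {M P p K} → M ℚ.≤ P ×ₙ 1ℚ → P ℕ.* p ℕ.< K → M * (p ×ₙ 1ℚ) < K ×ₙ 1ℚ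
scaled-< {M} {P} {p} {K} M≤P P*p<K = begin-strict
  M * (p ×ₙ 1ℚ)           ≤⟨ ℚₚ.*-monoʳ-≤-nonNeg (p ×ₙ 1ℚ) {{p≥0}} M≤P ⟩
  (P ×ₙ 1ℚ) * (p ×ₙ 1ℚ)   ≡⟨ ×1-homo-* P p ⟨
  (P ℕ.* p) ×ₙ 1ℚ         <⟨ ×ₙ1-< P*p<K ⟩
  K ×ₙ 1ℚ                 ∎
  where
  open ℚₚ.≤-Reasoning
  p≥0 : ℚ.NonNegative (p ×ₙ 1ℚ)
  p≥0 = ℚ.nonNegative (×ₙ1-nonneg p)

-- Resolving functions
weight≡sum : (g : Fin n → ℚ) (P : Fin n → Bool) → weight g P ≡ sum (λ z → if P z then g z else 0ℚ)
weight≡sum {n} g P = trans (cong (foldr ℚ._+_ 0ℚ) (map-tabulate id f)) (foldr-tabulate f)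
  where
  f : Fin n → ℚ
  f z = if P z then g z else 0ℚ
  foldr-tabulate : ∀ {n} (f : Fin n → ℚ) → foldr ℚ._+_ 0ℚ (tabulate f) ≡ sum f
  foldr-tabulate {zero}  f = refl
  foldr-tabulate {suc n} f = cong (f zero ℚ.+_) (foldr-tabulate (f ∘ suc))

total≡sum : (g : Fin n → ℚ) → total g ≡ sum g
total≡sum g = weight≡sum g (λ _ → true)

weight-cong : (g : Fin n → ℚ) {P Q : Fin n → Bool} → (∀ z → P z ≡ Q z) → weight g P ≡ weight g Q
weight-cong g {P} {Q} P≗Q = begin
  weight g P                                ≡⟨ weight≡sum g P ⟩
  sum (λ z → if P z then g z else 0ℚ)       ≡⟨ sum-cong-≗ (λ z → cong (if_then g z else 0ℚ) (P≗Q z)) ⟩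
  sum (λ z → if Q z then g z else 0ℚ)       ≡⟨ weight≡sum g Q ⟨
  weight g Q                                ∎
  where open ≡-Reasoning

resolves : (Fin n → Fin n → ℕ) → Fin n → Fin n → Fin n → Bool
resolves D x y z = not (D x z ≡ᵇ D y z)

resolves-≢ : {D : Fin n → Fin n → ℕ} {x y z : Fin n} → D x z ≢ D y z → resolves D x y z ≡ true
resolves-≢ {D = D} {x} {y} {z} ≢ =
  cong not (¬-not (≢ ∘ ℕₚ.≡ᵇ⇒≡ (D x z) (D y z) ∘ Equivalence.from T-≡))

resolves-≡ : {D : Fin n → Fin n → ℕ} {x y z : Fin n} → D x z ≡ D y z → resolves D x y z ≡ false
resolves-≡ {D = D} {x} {y} {z} ≡ = cong not (Equivalence.to T-≡ (ℕₚ.≡⇒≡ᵇ (D x z) (D y z) ≡))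

if-≤ : ∀ b {a} → 0ℚ ℚ.≤ a → (if b then a else 0ℚ) ℚ.≤ a
if-≤ true  _   = ℚₚ.≤-refl
if-≤ false 0≤a = 0≤a

if-nonneg : ∀ b {a} → 0ℚ ℚ.≤ a → 0ℚ ℚ.≤ (if b then a else 0ℚ)
if-nonneg true  0≤a = 0≤a
if-nonneg false _   = ℚₚ.≤-refl

Twins : (Fin n → Fin n → ℕ) → Fin n → Fin n → Set
Twins D x y = ∀ z → z ≢ x → z ≢ y → D x z ≡ D y z

twins-bound : {D : Fin n → Fin n → ℕ} {h : Fin n → ℚ} {x y : Fin n} →
  Twins D x y → x ≢ y → Resolving D h → 1ℚ ℚ.≤ h x ℚ.+ h y
twins-bound {D = D} {h} {x} {y} twins x≢y (h≥0 , _ , resolving) = begin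
  1ℚ                       ≤⟨ resolving x y x≢y ⟩
  weight h (resolves D x y) ≡⟨ weight≡sum h (resolves D x y) ⟩
  sum f                    ≡⟨ sum-supported-on-pair x≢y unresolved ⟩
  f x ℚ.+ f y              ≤⟨ ℚₚ.+-mono-≤ (f≤h x) (f≤h y) ⟩
  h x ℚ.+ h y              ∎
  where
  open ℚₚ.≤-Reasoning
  f : Fin _ → ℚ
  f z = if resolves D x y z then h z else 0ℚ
  f≤h : ∀ z → f z ℚ.≤ h z
  f≤h z = if-≤ (resolves D x y z) (h≥0 z)
  unresolved : ∀ z → z ≢ x → z ≢ y → f z ≡ 0ℚ
  unresolved z z≢x z≢y rewrite resolves-≡ {D = D} (twins z z≢x z≢y) = refl

↑ˡ≢↑ʳ : ∀ {m} (i j : Fin m) → i ↑ˡ m ≢ m ↑ʳ j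
↑ˡ≢↑ʳ {m} i j eq with trans (sym (splitAt-↑ˡ m i m)) (trans (cong (splitAt m) eq) (splitAt-↑ʳ m m j))
... | ()

twin-pairs-bound : {D : Fin n → Fin n → ℕ} {h : Fin n → ℚ} (e : Fin (m + m) → Fin n) →
  Injective _≡_ _≡_ e → (∀ i → Twins D (e (i ↑ˡ m)) (e (m ↑ʳ i))) → Resolving D h →
  m ×ₙ 1ℚ ℚ.≤ total h
twin-pairs-bound {m = m} {D = D} {h} e e-inj twins resolving@(h≥0 , _) = begin
  m ×ₙ 1ℚ                                            ≡⟨ sum-replicate m ⟨
  sum {m} (λ _ → 1ℚ)                                 ≤⟨ sum-mono-≤ pair-bound ⟩
  sum (λ i → h (e (i ↑ˡ m)) ℚ.+ h (e (m ↑ʳ i)))      ≡⟨ ∑-distrib-+ (h ∘ e ∘ (_↑ˡ m)) _ ⟩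
  sum (h ∘ e ∘ (_↑ˡ m)) ℚ.+ sum (h ∘ e ∘ (m ↑ʳ_))    ≡⟨ sum-↑ m (h ∘ e) ⟨
  sum (h ∘ e)                                        ≤⟨ sum-injective-≤ h≥0 e e-inj ⟩
  sum h                                              ≡⟨ total≡sum h ⟨
  total h                                            ∎
  where
  open ℚₚ.≤-Reasoning
  pair-bound : ∀ i → 1ℚ ℚ.≤ h (e (i ↑ˡ m)) ℚ.+ h (e (m ↑ʳ i))
  pair-bound i = twins-bound {D = D} (twins i) (↑ˡ≢↑ʳ i i ∘ e-inj) resolving

record DistinctPair {A : Set} (S : A → Bool) (R : A → Set) : Set where
  constructor distinctPair
  field
    z₁ z₂ : A
    z₁≢z₂ : z₁ ≢ z₂
    z₁∈S  : S z₁ ≡ true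
    z₂∈S  : S z₂ ≡ true
    R-z₁  : R z₁
    R-z₂  : R z₂

mapDistinctPair : {A B : Set} {S : A → Bool} {S′ : B → Bool} {R : A → Set} {R′ : B → Set}
  (f : A → B) → Injective _≡_ _≡_ f → (∀ {z} → S z ≡ true → S′ (f z) ≡ true) →
  (∀ {z} → R z → R′ (f z)) → DistinctPair S R → DistinctPair S′ R′
mapDistinctPair f f-inj S⇒S′ R⇒R′ (distinctPair z₁ z₂ z₁≢z₂ z₁∈S z₂∈S R-z₁ R-z₂) =
  distinctPair (f z₁) (f z₂) (z₁≢z₂ ∘ f-inj) (S⇒S′ z₁∈S) (S⇒S′ z₂∈S)
    (R⇒R′ R-z₁) (R⇒R′ R-z₂)

halfOn : (Fin n → Bool) → Fin n → ℚ
halfOn S z = if S z then ½ else 0ℚ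

halves-resolving : {D : Fin n → Fin n → ℕ} (S : Fin n → Bool) →
  (∀ x y → x ≢ y → DistinctPair S (λ z → D x z ≢ D y z)) → Resolving D (halfOn S)
halves-resolving {D = D} S pairs = (λ z → if-nonneg (S z) 0≤½) , (λ z → halfOn≤1 (S z)) , resolved
  where
  0≤½ : 0ℚ ℚ.≤ ½
  0≤½ = from-yes (0ℚ ℚₚ.≤? ½)
  halfOn≤1 : ∀ b → (if b then ½ else 0ℚ) ℚ.≤ 1ℚ
  halfOn≤1 true  = from-yes (½ ℚₚ.≤? 1ℚ)
  halfOn≤1 false = from-yes (0ℚ ℚₚ.≤? 1ℚ)
  resolved : ∀ x y → x ≢ y → 1ℚ ℚ.≤ weight (halfOn S) (resolves D x y)
  resolved x y x≢y = begin
    1ℚ                                ≡⟨⟩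
    ½ ℚ.+ ½                           ≡⟨ cong₂ ℚ._+_ (at z₁∈S R-z₁) (at z₂∈S R-z₂) ⟨
    f z₁ ℚ.+ f z₂                     ≤⟨ pair-≤-sum f≥0 z₁≢z₂ ⟩
    sum f                             ≡⟨ weight≡sum (halfOn S) (resolves D x y) ⟨
    weight (halfOn S) (resolves D x y) ∎
    where
    open ℚₚ.≤-Reasoning
    open DistinctPair (pairs x y x≢y)
    f : Fin _ → ℚ
    f z = if resolves D x y z then halfOn S z else 0ℚ
    f≥0 : ∀ z → 0ℚ ℚ.≤ f z
    f≥0 z = if-nonneg (resolves D x y z) (if-nonneg (S z) 0≤½)
    at : ∀ {z} → S z ≡ true → D x z ≢ D y z → f z ≡ ½
    at {z} z∈S ≢ rewrite resolves-≢ {D = D} ≢ | z∈S = refl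

resolving-cong : {D D′ : Fin n → Fin n → ℕ} {g : Fin n → ℚ} → (∀ x y → D x y ≡ D′ x y) →
  Resolving D g → Resolving D′ g
resolving-cong {g = g} D≗D′ (g≥0 , g≤1 , resolved) = g≥0 , g≤1 , λ x y x≢y →
  subst (1ℚ ℚ.≤_) (weight-cong g (λ z → cong₂ (λ a b → not (a ≡ᵇ b)) (D≗D′ x z) (D≗D′ y z)))
    (resolved x y x≢y)

minResolving-cong : {D D′ : Fin n → Fin n → ℕ} {d : ℚ} → (∀ x y → D x y ≡ D′ x y) →
  IsMinResolvingValue D d → IsMinResolvingValue D′ d
minResolving-cong D≗D′ ((g , resolving , total≡d) , minimal) =
  (g , resolving-cong D≗D′ resolving , total≡d) ,
  λ h → minimal h ∘ resolving-cong (λ x y → sym (D≗D′ x y))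

-- Walks and distances
⌊≟⌋-refl : (x : Fin n) → ⌊ x ≟ x ⌋ ≡ true
⌊≟⌋-refl x = trans (isYes≗does (x ≟ x)) (dec-true (x ≟ x) refl)

⌊≟⌋-≢ : {x y : Fin n} → x ≢ y → ⌊ x ≟ y ⌋ ≡ false
⌊≟⌋-≢ {x = x} {y} x≢y = trans (isYes≗does (x ≟ y)) (dec-false (x ≟ y) x≢y)

any-allFin-witness : (b : Fin n → Bool) (z : Fin n) → b z ≡ true → any b (allFin n) ≡ true
any-allFin-witness b z bz = Equivalence.to T-≡ (any⁺ b (lose (∈-allFin z) (Equivalence.from T-≡ bz)))

any-allFin-at : (x : Fin n) (b : Fin n → Bool) → any (λ z → ⌊ x ≟ z ⌋ ∧ b z) (allFin n) ≡ b x
any-allFin-at {n} x b with b x in bx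
... | true  = any-allFin-witness _ x (cong₂ _∧_ (⌊≟⌋-refl x) bx)
... | false = ¬-not (λ t → only-at-x (satisfied (any⁻ _ (allFin n) (Equivalence.from T-≡ t))))
  where
  only-at-x : ¬ Σ (Fin n) (λ z → T (⌊ x ≟ z ⌋ ∧ b z))
  only-at-x (z , t) with x ≟ z
  ... | yes refl = subst T bx t
  ... | no _     = t

reach-refl : (G : Graph n) (x : Fin n) → reach G 0 x x ≡ true
reach-refl G = ⌊≟⌋-refl

reach-step : (G : Graph n) {k : ℕ} {x z y : Fin n} →
  reach G k x z ≡ true → adj G z y ≡ true → reach G (suc k) x y ≡ true
reach-step G {k} {x} {z} {y} xz zy =
  trans (cong (reach G k x y ∨_) (any-allFin-witness _ z (cong₂ _∧_ xz zy))) (∨-zeroʳ _)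

reach-suc : (G : Graph n) {k : ℕ} {x y : Fin n} → reach G k x y ≡ true → reach G (suc k) x y ≡ true
reach-suc G xy rewrite xy = refl

reach-mono : (G : Graph n) {k l : ℕ} {x y : Fin n} → k ≤ l → reach G k x y ≡ true → reach G l x y ≡ true
reach-mono G k≤l = go (ℕₚ.≤⇒≤′ k≤l)
  where
  go : ∀ {k l x y} → k ≤′ l → reach G k x y ≡ true → reach G l x y ≡ true
  go (≤′-reflexive refl)        = id
  go {l = suc l} (≤′-step k≤′l) = reach-suc G {l} ∘ go k≤′l

reach-adjacent : (G : Graph n) {x y : Fin n} → adj G x y ≡ true → reach G 1 x y ≡ true
reach-adjacent G {x} = reach-step G {0} (reach-refl G x)

reach-nonadjacent : (G : Graph n) {x y : Fin n} → x ≢ y → adj G x y ≡ false → reach G 1 x y ≡ false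
reach-nonadjacent G {x} {y} x≢y xy =
  cong₂ _∨_ (⌊≟⌋-≢ x≢y) (trans (any-allFin-at x (λ z → adj G z y)) xy)

dist-refl : (G : Graph n) (x : Fin n) → dist G x x ≡ 0
dist-refl G x rewrite ⌊≟⌋-refl x = refl

dist-adjacent : (G : Graph n) {x y : Fin n} → x ≢ y → adj G x y ≡ true → dist G x y ≡ 1
dist-adjacent {suc n} G {x} {y} x≢y xy =
  cong₂ (λ r₀ r₁ → if r₀ then 0 else if r₁ then 1 else distFrom G 2 n x y)
        (⌊≟⌋-≢ x≢y) (reach-adjacent G xy)

dist-common-neighbour : (G : Graph n) {x y c : Fin n} →
  x ≢ y → adj G x y ≡ false → adj G x c ≡ true → adj G c y ≡ true → dist G x y ≡ 2
dist-common-neighbour {suc zero}    G {zero} {zero} x≢y = contradiction refl x≢y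
dist-common-neighbour {suc (suc n)} G {x} {y} x≢y xy xc cy = trans
  (cong₂ (λ r₀ r₁ → if r₀ then 0 else if r₁ then 1 else if reach G 2 x y then 2 else rest)
         (⌊≟⌋-≢ x≢y) (reach-nonadjacent G x≢y xy))
  (cong (λ r₂ → if r₂ then 2 else rest) (reach-step G {1} {x} (reach-adjacent G xc) cy))
  where
  rest : ℕ
  rest = distFrom G 3 n x y

-- Graphs with a dominating vertex
Dominating : Graph n → Fin n → Set
Dominating G c = ∀ y → y ≢ c → adj G c y ≡ true

common-neighbour : (G : Graph n) {c x y : Fin n} → Dominating G c → x ≢ y → adj G x y ≡ false →
  adj G x c ≡ true × adj G c y ≡ true
common-neighbour G {c} {x} {y} dom x≢y xy with x ≟ c | y ≟ c
... | yes refl | _        = contradiction (trans (sym (dom y (≢-sym x≢y))) xy) λ ()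
... | no _     | yes refl = contradiction (trans (sym (dom x x≢y)) (trans (Graph.sym G c x) xy)) λ ()
... | no x≢c   | no y≢c   = trans (Graph.sym G x c) (dom x x≢c) , dom y y≢c

distinct⇒2≤n : {x y : Fin n} → x ≢ y → 2 ≤ n
distinct⇒2≤n {suc zero}    {zero} {zero} x≢y = contradiction refl x≢y
distinct⇒2≤n {suc (suc n)} _                 = s≤s (s≤s z≤n)

dominating-reach-2 : (G : Graph n) {c x y : Fin n} → Dominating G c → x ≢ y → reach G 2 x y ≡ true
dominating-reach-2 G {c} {x} {y} dom x≢y with adj G x y in xy
... | true  = reach-suc G {1} {x} (reach-adjacent G xy)
... | false = reach-step G {1} {x} (reach-adjacent G (proj₁ shared)) (proj₂ shared)
  where
  shared : adj G x c ≡ true × adj G c y ≡ true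
  shared = common-neighbour G dom x≢y xy

dominating-connected : (G : Graph n) {c : Fin n} → Dominating G c → Connected G
dominating-connected {n} G dom x y with x ≟ y
... | yes refl = reach-mono G {0} {n} {x} z≤n (reach-refl G x)
... | no x≢y   = reach-mono G {2} {n} {x} (distinct⇒2≤n x≢y) (dominating-reach-2 G dom x≢y)

adjDist : Bool → ℕ
adjDist true  = 1
adjDist false = 2

adjDist≢0 : ∀ b → adjDist b ≢ 0
adjDist≢0 true  ()
adjDist≢0 false ()

adjDist-injective : ∀ {a b} → adjDist a ≡ adjDist b → a ≡ b
adjDist-injective {true}  {true}  _ = refl
adjDist-injective {false} {false} _ = refl

dominating-dist : (G : Graph n) {c x y : Fin n} → Dominating G c → x ≢ y → dist G x y ≡ adjDist (adj G x y)
dominating-dist G {c} {x} {y} dom x≢y with adj G x y in xy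
... | true  = dist-adjacent G x≢y xy
... | false = dist-common-neighbour G x≢y xy (proj₁ shared) (proj₂ shared)
  where
  shared : adj G x c ≡ true × adj G c y ≡ true
  shared = common-neighbour G dom x≢y xy

dominating-twins : (G : Graph n) {c x y : Fin n} → Dominating G c →
  (∀ z → z ≢ x → z ≢ y → adj G x z ≡ adj G y z) → Twins (dist G) x y
dominating-twins G {x = x} {y} dom same z z≢x z≢y = begin
  dist G x z            ≡⟨ dominating-dist G dom (≢-sym z≢x) ⟩
  adjDist (adj G x z)   ≡⟨ cong adjDist (same z z≢x z≢y) ⟩
  adjDist (adj G y z)   ≡⟨ dominating-dist G dom (≢-sym z≢y) ⟨
  dist G y z            ∎
  where open ≡-Reasoning

dominating-truncFracDim : (G : Graph n) {c : Fin n} {k : ℕ} {d : ℚ} → Dominating G c → 1 ≤ k →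
  IsFracDim G d → IsTruncFracDim k G d
dominating-truncFracDim G dom 1≤k = minResolving-cong λ x y →
  sym (ℕₚ.m≤n⇒m⊓n≡m (ℕₚ.≤-trans (dist≤2 x y) (s≤s 1≤k)))
  where
  adjDist≤2 : ∀ b → adjDist b ≤ 2
  adjDist≤2 true  = s≤s z≤n
  adjDist≤2 false = ℕₚ.≤-refl
  dist≤2 : ∀ x y → dist G x y ≤ 2
  dist≤2 x y = by-cases (x ≟ y)
    where
    by-cases : Dec (x ≡ y) → dist G x y ≤ 2
    by-cases (yes refl) = subst (_≤ 2) (sym (dist-refl G x)) z≤n
    by-cases (no x≢y)   = subst (_≤ 2) (sym (dominating-dist G dom x≢y)) (adjDist≤2 _)

data Separates {V : Set} (A : V → V → Bool) (x y z : V) : Set where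
  left      : z ≡ x → Separates A x y z
  right     : z ≡ y → Separates A x y z
  adjacency : z ≢ x → z ≢ y → A x z ≢ A y z → Separates A x y z

separates-sym : {V : Set} {A : V → V → Bool} {x y z : V} → Separates A x y z → Separates A y x z
separates-sym (left z≡x)                   = right z≡x
separates-sym (right z≡y)                  = left z≡y
separates-sym (adjacency z≢x z≢y differ)   = adjacency z≢y z≢x (differ ∘ sym)

separated-sym : {V : Set} {A : V → V → Bool} {S : V → Bool} {x y : V} →
  DistinctPair S (Separates A x y) → DistinctPair S (Separates A y x)
separated-sym = mapDistinctPair id id id separates-sym

dominating-separates : (G : Graph n) {c x y z : Fin n} → Dominating G c → x ≢ y →
  Separates (adj G) x y z → dist G x z ≢ dist G y z
dominating-separates G dom x≢y (left refl) eq =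
  adjDist≢0 _ (trans (sym (dominating-dist G dom (≢-sym x≢y))) (trans (sym eq) (dist-refl G _)))
dominating-separates G dom x≢y (right refl) eq =
  adjDist≢0 _ (trans (sym (dominating-dist G dom x≢y)) (trans eq (dist-refl G _)))
dominating-separates G {x = x} {y} {z} dom x≢y (adjacency z≢x z≢y differ) eq =
  differ (adjDist-injective (begin
    adjDist (adj G x z)   ≡⟨ dominating-dist G dom (≢-sym z≢x) ⟨
    dist G x z            ≡⟨ eq ⟩
    dist G y z            ≡⟨ dominating-dist G dom (≢-sym z≢y) ⟩
    adjDist (adj G y z)   ∎))
  where open ≡-Reasoning

dominating-halves-resolving : (G : Graph n) {c : Fin n} → Dominating G c → (S : Fin n → Bool) →
  (∀ x y → x ≢ y → DistinctPair S (Separates (adj G) x y)) → Resolving (dist G) (halfOn S)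
dominating-halves-resolving G dom S separated = halves-resolving S λ x y x≢y →
  mapDistinctPair id id id (dominating-separates G dom x≢y) (separated x y x≢y)

-- Stars
swapHalves : ∀ m → Fin (m + m) → Fin (m + m)
swapHalves m i = join m m (Sum.swap (splitAt m i))

swapHalves-≢ : ∀ m (i : Fin (m + m)) → swapHalves m i ≢ i
swapHalves-≢ m i eq = swap-≢ (splitAt m i) (trans (sym (splitAt-join m m _)) (cong (splitAt m) eq))
  where
  swap-≢ : (s : Fin m ⊎ Fin m) → Sum.swap s ≢ s
  swap-≢ (inj₁ _) ()
  swap-≢ (inj₂ _) ()

star-adj : Fin (suc n) → Fin (suc n) → Bool
star-adj zero    zero    = false
star-adj zero    (suc _) = true
star-adj (suc _) zero    = true
star-adj (suc _) (suc _) = false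

star : ∀ n → Graph (suc n)
star n = record { adj = star-adj ; sym = star-adj-sym ; irrefl = star-adj-irrefl }
  where
  star-adj-sym : ∀ x y → star-adj x y ≡ star-adj y x
  star-adj-sym zero    zero    = refl
  star-adj-sym zero    (suc _) = refl
  star-adj-sym (suc _) zero    = refl
  star-adj-sym (suc _) (suc _) = refl
  star-adj-irrefl : ∀ x → star-adj x x ≡ false
  star-adj-irrefl zero    = refl
  star-adj-irrefl (suc _) = refl

star-dominating : Dominating (star n) zero
star-dominating zero    0≢0 = contradiction refl 0≢0
star-dominating (suc _) _   = refl

star-subgraph : (G : Graph (suc n)) → Dominating G zero → Subgraph (star n) G
star-subgraph G dom = id , (λ _ _ → id) , edge
  where
  edge : ∀ x y → star-adj x y ≡ true → adj G x y ≡ true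
  edge zero    (suc j) _ = dom (suc j) λ ()
  edge (suc i) zero    _ = trans (Graph.sym G (suc i) zero) (dom (suc i) λ ())

fracDim-star : ∀ m → IsFracDim (star (m + m)) (m ×ₙ 1ℚ)
fracDim-star m = (halfOn isLeaf , resolving , total-halfOn) , lower-bound
  where
  isLeaf : Fin (suc (m + m)) → Bool
  isLeaf zero    = false
  isLeaf (suc _) = true
  separated : ∀ x y → x ≢ y → DistinctPair isLeaf (Separates star-adj x y)
  separated zero    zero    0≢0 = contradiction refl 0≢0
  separated zero    (suc j) _   =
    distinctPair (suc j) (suc (swapHalves m j)) (swapHalves-≢ m j ∘ sym ∘ suc-injective) refl refl
      (right refl) (adjacency (λ ()) (swapHalves-≢ m j ∘ suc-injective) λ ())
  separated (suc i) zero    i≢0 = separated-sym (separated zero (suc i) (≢-sym i≢0))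
  separated (suc i) (suc j) i≢j = distinctPair (suc i) (suc j) i≢j refl refl (left refl) (right refl)
  resolving : Resolving (dist (star (m + m))) (halfOn isLeaf)
  resolving = dominating-halves-resolving (star (m + m)) star-dominating isLeaf separated
  total-halfOn : total (halfOn isLeaf) ≡ m ×ₙ 1ℚ
  total-halfOn = trans (total≡sum (halfOn isLeaf)) (trans (ℚₚ.+-identityˡ _) (sum-halves m))
  leaves-twins : ∀ i → Twins (dist (star (m + m))) (suc (i ↑ˡ m)) (suc (m ↑ʳ i))
  leaves-twins i = dominating-twins (star (m + m)) star-dominating same-neighbours
    where
    same-neighbours : ∀ z → z ≢ suc (i ↑ˡ m) → z ≢ suc (m ↑ʳ i) →
      star-adj (suc (i ↑ˡ m)) z ≡ star-adj (suc (m ↑ʳ i)) z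
    same-neighbours zero    _ _ = refl
    same-neighbours (suc _) _ _ = refl
  lower-bound : ∀ h → Resolving (dist (star (m + m))) h → m ×ₙ 1ℚ ℚ.≤ total h
  lower-bound h = twin-pairs-bound {D = dist (star (m + m))} suc suc-injective leaves-twins

-- Cones over doubled incidence structures
true-false⇒≢ : ∀ {a b : Bool} → a ≡ true → b ≡ false → a ≢ b
true-false⇒≢ refl refl ()

record Separating {p q : ℕ} (I : Fin q → Fin p → Bool) : Set where
  field
    incident    : ∀ x → Σ (Fin p) λ c → I x c ≡ true
    nonincident : ∀ x → Σ (Fin p) λ c → I x c ≡ false
    distinguish : ∀ x y → x ≢ y → Σ (Fin p) λ c → I x c ≢ I y c

-- The cone over the incidence graph of I in which every point c is doubled into the twins
-- point false c and point true c.
module Incidence {p q : ℕ} (I : Fin q → Fin p → Bool) where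

  data Vertex : Set where
    apex  : Vertex
    point : Bool → Fin p → Vertex
    block : Fin q → Vertex

  vertex : Fin (suc ((p + p) + q)) → Vertex
  vertex zero    = apex
  vertex (suc v) = [ [ point false , point true ]′ ∘ splitAt p , block ]′ (splitAt (p + p) v)

  index : Vertex → Fin (suc ((p + p) + q))
  index apex            = zero
  index (point false c) = suc ((c ↑ˡ p) ↑ˡ q)
  index (point true  c) = suc ((p ↑ʳ c) ↑ˡ q)
  index (block x)       = suc ((p + p) ↑ʳ x)

  vertex-index : ∀ v → vertex (index v) ≡ v
  vertex-index apex            = refl
  vertex-index (point false c) rewrite splitAt-↑ˡ (p + p) (c ↑ˡ p) q | splitAt-↑ˡ p c p = refl
  vertex-index (point true  c) rewrite splitAt-↑ˡ (p + p) (p ↑ʳ c) q | splitAt-↑ʳ p p c = refl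
  vertex-index (block x)       rewrite splitAt-↑ʳ (p + p) q x = refl

  index-vertex : ∀ i → index (vertex i) ≡ i
  index-vertex zero = refl
  index-vertex (suc v) with splitAt (p + p) v in eq
  ... | inj₂ x = cong suc (splitAt⁻¹-↑ʳ eq)
  ... | inj₁ s with splitAt p s in eq′
  ...   | inj₁ c = cong suc (trans (cong (_↑ˡ q) (splitAt⁻¹-↑ˡ eq′)) (splitAt⁻¹-↑ˡ eq))
  ...   | inj₂ c = cong suc (trans (cong (_↑ˡ q) (splitAt⁻¹-↑ʳ eq′)) (splitAt⁻¹-↑ˡ eq))

  index-injective : Injective _≡_ _≡_ index
  index-injective {u} {w} eq = trans (sym (vertex-index u)) (trans (cong vertex eq) (vertex-index w))

  adjV : Vertex → Vertex → Bool
  adjV apex        apex        = false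
  adjV apex        (point _ _) = true
  adjV apex        (block _)   = true
  adjV (point _ _) apex        = true
  adjV (point _ _) (point _ _) = false
  adjV (point _ c) (block x)   = I x c
  adjV (block _)   apex        = true
  adjV (block x)   (point _ c) = I x c
  adjV (block _)   (block _)   = false

  adjV-sym : ∀ u w → adjV u w ≡ adjV w u
  adjV-sym apex        apex        = refl
  adjV-sym apex        (point _ _) = refl
  adjV-sym apex        (block _)   = refl
  adjV-sym (point _ _) apex        = refl
  adjV-sym (point _ _) (point _ _) = refl
  adjV-sym (point _ _) (block _)   = refl
  adjV-sym (block _)   apex        = refl
  adjV-sym (block _)   (point _ _) = refl
  adjV-sym (block _)   (block _)   = refl

  adjV-irrefl : ∀ u → adjV u u ≡ false
  adjV-irrefl apex        = refl
  adjV-irrefl (point _ _) = refl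
  adjV-irrefl (block _)   = refl

  graph : Graph (suc ((p + p) + q))
  graph = record
    { adj    = λ u w → adjV (vertex u) (vertex w)
    ; sym    = λ u w → adjV-sym (vertex u) (vertex w)
    ; irrefl = λ u → adjV-irrefl (vertex u)
    }

  dominating : Dominating graph zero
  dominating y y≢0 = apex-adjacent (vertex y) (y≢0 ∘ trans (sym (index-vertex y)) ∘ cong index)
    where
    apex-adjacent : ∀ v → v ≢ apex → adjV apex v ≡ true
    apex-adjacent apex        v≢apex = contradiction refl v≢apex
    apex-adjacent (point _ _) _      = refl
    apex-adjacent (block _)   _      = refl

  isPoint : Vertex → Bool
  isPoint (point _ _) = true
  isPoint _           = false

  points : Fin (suc ((p + p) + q)) → Bool
  points = isPoint ∘ vertex

  point-injective : ∀ {b b′ c c′} → point b c ≡ point b′ c′ → b ≡ b′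
  point-injective refl = refl

  copies-differ : ∀ b {c c′} → point (not b) c ≢ point b c′
  copies-differ b = not-¬ refl ∘ sym ∘ point-injective

  module _ (separating : Separating I) where
    open Separating separating

    separated : ∀ u w → u ≢ w → DistinctPair isPoint (Separates adjV u w)
    separated apex apex ne = contradiction refl ne
    separated apex (point b c) _ =
      distinctPair (point b c) (point (not b) c) (copies-differ b ∘ sym) refl refl
        (right refl) (adjacency (λ ()) (copies-differ b) λ ())
    separated apex (block x) _ with nonincident x
    ... | c , x∤c = distinctPair (point false c) (point true c) (λ ()) refl refl
        (adjacency (λ ()) (λ ()) (true-false⇒≢ refl x∤c))
        (adjacency (λ ()) (λ ()) (true-false⇒≢ refl x∤c))
    separated (point b c) (point b′ c′) ne =
      distinctPair (point b c) (point b′ c′) ne refl refl (left refl) (right refl)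
    separated (point b c) (block x) _ with incident x
    ... | c′ , x∣c′ = distinctPair (point b c) (point (not b) c′) (copies-differ b ∘ sym) refl refl
        (left refl) (adjacency (copies-differ b) (λ ()) (≢-sym (true-false⇒≢ x∣c′ refl)))
    separated (block x) (block y) ne with distinguish x y (ne ∘ cong block)
    ... | c , differ = distinctPair (point false c) (point true c) (λ ()) refl refl
        (adjacency (λ ()) (λ ()) differ) (adjacency (λ ()) (λ ()) differ)
    separated u@(point _ _) apex          ne = separated-sym (separated apex u (≢-sym ne))
    separated u@(block _)   apex          ne = separated-sym (separated apex u (≢-sym ne))
    separated u@(block _)   w@(point _ _) ne = separated-sym (separated w u (≢-sym ne))

    graph-separated : ∀ x y → x ≢ y → DistinctPair points (Separates (adj graph) x y)
    graph-separated x y x≢y = mapDistinctPair index index-injective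
      (λ {z} z∈S → trans (cong isPoint (vertex-index z)) z∈S) separates-index
      (separated (vertex x) (vertex y) (x≢y ∘ vertex-injective))
      where
      vertex-injective : Injective _≡_ _≡_ vertex
      vertex-injective {i} {j} eq = trans (sym (index-vertex i)) (trans (cong index eq) (index-vertex j))
      index≢ : ∀ {z i} → z ≢ vertex i → index z ≢ i
      index≢ {z} z≢ eq = z≢ (trans (sym (vertex-index z)) (cong vertex eq))
      separates-index : ∀ {z} → Separates adjV (vertex x) (vertex y) z → Separates (adj graph) x y (index z)
      separates-index (left refl)  = left (index-vertex x)
      separates-index (right refl) = right (index-vertex y)
      separates-index {z} (adjacency z≢x z≢y differ) = adjacency (index≢ z≢x) (index≢ z≢y)
        (subst (λ w → adjV (vertex x) w ≢ adjV (vertex y) w) (sym (vertex-index z)) differ)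

  twins : ∀ c → Twins (dist graph) (index (point false c)) (index (point true c))
  twins c = dominating-twins graph dominating same-neighbours
    where
    same-neighbours : ∀ z → z ≢ index (point false c) → z ≢ index (point true c) →
      adjV (vertex (index (point false c))) (vertex z) ≡ adjV (vertex (index (point true c))) (vertex z)
    same-neighbours z _ _ rewrite vertex-index (point false c) | vertex-index (point true c) = copies (vertex z)
      where
      copies : ∀ w → adjV (point false c) w ≡ adjV (point true c) w
      copies apex        = refl
      copies (point _ _) = refl
      copies (block _)   = refl

  total-halfOn : total (halfOn points) ≡ p ×ₙ 1ℚ
  total-halfOn = begin
    total (halfOn points)                                       ≡⟨ total≡sum (halfOn points) ⟩
    0ℚ ℚ.+ sum (halfOn points ∘ suc)                            ≡⟨ ℚₚ.+-identityˡ _ ⟩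
    sum (halfOn points ∘ suc)                                   ≡⟨ sum-↑ (p + p) _ ⟩
    sum (halfOn points ∘ suc ∘ (_↑ˡ q)) ℚ.+ sum (halfOn points ∘ suc ∘ ((p + p) ↑ʳ_))
      ≡⟨ cong₂ ℚ._+_ (sum-cong-≗ (cong (if_then ½ else 0ℚ) ∘ copies))
                     (sum-zero (cong (if_then ½ else 0ℚ) ∘ blocks)) ⟩
    sum {p + p} (λ _ → ½) ℚ.+ 0ℚ                                ≡⟨ ℚₚ.+-identityʳ _ ⟩
    sum {p + p} (λ _ → ½)                                       ≡⟨ sum-halves p ⟩
    p ×ₙ 1ℚ                                                     ∎
    where
    open ≡-Reasoning
    copies : ∀ s → points (suc (s ↑ˡ q)) ≡ true
    copies s rewrite splitAt-↑ˡ (p + p) s q with splitAt p s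
    ... | inj₁ _ = refl
    ... | inj₂ _ = refl
    blocks : ∀ x → points (suc ((p + p) ↑ʳ x)) ≡ false
    blocks x rewrite splitAt-↑ʳ (p + p) q x = refl

  fracDim : Separating I → IsFracDim graph (p ×ₙ 1ℚ)
  fracDim separating = (halfOn points , resolving , total-halfOn) , lower-bound
    where
    resolving : Resolving (dist graph) (halfOn points)
    resolving = dominating-halves-resolving graph dominating points (graph-separated separating)
    lower-bound : ∀ h → Resolving (dist graph) h → p ×ₙ 1ℚ ℚ.≤ total h
    lower-bound h =
      twin-pairs-bound {D = dist graph} (suc ∘ (_↑ˡ q)) (↑ˡ-injective q _ _ ∘ suc-injective) twins

onLine : ∀ {t} → Fin t × Fin t → Fin t ⊎ Fin t → Bool
onLine (i , _) (inj₁ row) = ⌊ row ≟ i ⌋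
onLine (_ , j) (inj₂ col) = ⌊ col ≟ j ⌋

grid : ∀ t → Fin (t ℕ.* t) → Fin (t + t) → Bool
grid t x c = onLine (remQuot t x) (splitAt t c)

onLine-distinguish : ∀ {t} (a b : Fin t × Fin t) → a ≢ b →
  Σ (Fin t ⊎ Fin t) λ ℓ → onLine a ℓ ≢ onLine b ℓ
onLine-distinguish (i , j) (i′ , j′) a≢b with i ≟ i′
... | no i≢i′  = inj₁ i , true-false⇒≢ (⌊≟⌋-refl i) (⌊≟⌋-≢ i≢i′)
... | yes refl = inj₂ j , true-false⇒≢ (⌊≟⌋-refl j) (⌊≟⌋-≢ (a≢b ∘ cong (i ,_)))

grid-separating : ∀ r → Separating (grid (r + r))
grid-separating r = record { incident = incident ; nonincident = nonincident ; distinguish = distinguish }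
  where
  t : ℕ
  t = r + r
  on : ∀ x ℓ → grid t x (join t t ℓ) ≡ onLine (remQuot t x) ℓ
  on x ℓ = cong (onLine (remQuot t x)) (splitAt-join t t ℓ)
  incident : ∀ x → Σ (Fin (t + t)) λ c → grid t x c ≡ true
  incident x = join t t (inj₁ row) , trans (on x (inj₁ row)) (⌊≟⌋-refl row)
    where
    row : Fin t
    row = proj₁ (remQuot t x)
  nonincident : ∀ x → Σ (Fin (t + t)) λ c → grid t x c ≡ false
  nonincident x = join t t (inj₁ other) , trans (on x (inj₁ other)) (⌊≟⌋-≢ (swapHalves-≢ r row))
    where
    row other : Fin t
    row   = proj₁ (remQuot t x)
    other = swapHalves r row
  remQuot-injective : ∀ {x y} → remQuot {t} t x ≡ remQuot t y → x ≡ y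
  remQuot-injective {x} {y} eq =
    trans (sym (combine-remQuot {t} t x)) (trans (cong (uncurry combine) eq) (combine-remQuot {t} t y))
  distinguish : ∀ x y → x ≢ y → Σ (Fin (t + t)) λ c → grid t x c ≢ grid t y c
  distinguish x y x≢y with onLine-distinguish (remQuot t x) (remQuot t y) (x≢y ∘ remQuot-injective)
  ... | ℓ , differ = join t t ℓ , λ eq → differ (trans (sym (on x ℓ)) (trans eq (on y ℓ)))

-- t is even so that the star on (p + p) + q leaves has 2K of them, and r > 2P gives P p < K.
module Witnesses (P : ℕ) where

  r t p q K : ℕ
  r = suc (P + P)
  t = r + r
  p = t + t
  q = t ℕ.* t
  K = p + r ℕ.* t

  open Incidence (grid t) public using (graph; dominating)

  H : Graph (suc ((p + p) + q))
  H = star ((p + p) + q)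

  dimH : IsFracDim H (K ×ₙ 1ℚ)
  dimH = subst (λ n → IsFracDim (star n) (K ×ₙ 1ℚ)) K+K≡p+p+q (fracDim-star K)
    where
    K+K≡p+p+q : K + K ≡ (p + p) + q
    K+K≡p+p+q = solve 1 (λ P → let r = con 1 :+ (P :+ P) ; t = r :+ r ; p = t :+ t in
      (p :+ r :* t) :+ (p :+ r :* t) := (p :+ p) :+ t :* t) refl P

  dimG : IsFracDim graph (p ×ₙ 1ℚ)
  dimG = Incidence.fracDim (grid t) (grid-separating r)

  0<dimG : 0ℚ < p ×ₙ 1ℚ
  0<dimG = ×ₙ1-< {0} {p} (s≤s z≤n)

  P*p<K : P ℕ.* p ℕ.< K
  P*p<K = subst (P ℕ.* p ℕ.<_) (sym K≡P*p+t+p) (ℕₚ.m<m+n (P ℕ.* p) (s≤s z≤n))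
    where
    K≡P*p+t+p : K ≡ P ℕ.* p + (t + p)
    K≡P*p+t+p = solve 1 (λ P → let r = con 1 :+ (P :+ P) ; t = r :+ r ; p = t :+ t in
      p :+ r :* t := P :* p :+ (t :+ p)) refl P

corollary4p2 : (k : ℕ) → 1 ≤ k → (M : ℚ) → 0ℚ < M →
    Σ ℕ λ m → Σ ℕ λ n → Σ (Graph m) λ H → Σ (Graph n) λ G →
      Connected H × Connected G × Subgraph H G ×
      Σ ℚ λ dH → Σ ℚ λ dG → Σ ℚ λ dHk → Σ ℚ λ dGk →
        IsFracDim H dH × IsFracDim G dG ×
        IsTruncFracDim k H dHk × IsTruncFracDim k G dGk ×
        0ℚ < dG × 0ℚ < dGk × M * dG < dH × M * dGk < dHk
corollary4p2 k 1≤k M _ with archimedean M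
... | P , M≤P =
  _ , _ , H , graph ,
  dominating-connected H star-dominating , dominating-connected graph dominating ,
  star-subgraph graph dominating ,
  K ×ₙ 1ℚ , p ×ₙ 1ℚ , K ×ₙ 1ℚ , p ×ₙ 1ℚ ,
  dimH , dimG ,
  dominating-truncFracDim H star-dominating 1≤k dimH ,
  dominating-truncFracDim graph dominating 1≤k dimG ,
  0<dimG , 0<dimG , ratio , ratio
  where
  open Witnesses P
  ratio : M * (p ×ₙ 1ℚ) < K ×ₙ 1ℚ
  ratio = scaled-< {M} {P} {p} {K} M≤P P*p<K
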